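{- Let $G=(V,A)$ be a flow graph with start vertex $s$ and dominator tree $D$, and let $T$ be a rooted tree whose vertex set is a subset of $V$. Then $T$ has both the parent property and the sibling property if and only if $T=D$.
   Context: A flow graph is a finite directed graph $G=(V,A)$ with a designated start vertex $s$ such that every vertex is reachable from $s$; throughout, there are no arcs entering $s$ and $|V|>1$. A vertex $v$ dominates $w$ if every path from $s$ to $w$ contains $v$. The dominator tree $D$ is the tree rooted at $s$ on $V$ in which $v$ is an ancestor of $w$ iff $v$ dominates $w$. For a rooted tree $T$, $t(v)$ denotes the parent of $v$; ancestors include the vertex itself. $T$ has the parent property if for every arc $(v,w)\in A$, $t(w)$ is an ancestor of $v$ in $T$. $T$ has the sibling property if for all siblings $v,w$ in $T$, $v$ does not dominate $w$. -}

module Defs where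

open import Data.Nat using (ℕ; _<_)
open import Data.Fin using (Fin)
open import Data.Bool using (Bool; true)
open import Data.List using (List; []; _∷_)
open import Data.List.Membership.Propositional using (_∈_)
open import Data.Product using (_×_; ∃)
open import Relation.Binary.PropositionalEquality using (_≡_; _≢_)
open import Relation.Nullary using (¬_)

record Digraph (n : ℕ) : Set where
  field
    adj : Fin n → Fin n → Bool

  Arc : Fin n → Fin n → Set
  Arc v w = adj v w ≡ true

  data Walk : Fin n → Fin n → Set where
    [] : ∀ {u} → Walk u u
    _∷_ : ∀ {u v w} → Arc u v → Walk v w → Walk u w

  verts : ∀ {u v} → Walk u v → List (Fin n)
  verts {u} [] = u ∷ []
  verts {u} (_ ∷ p) = u ∷ verts p

open Digraph public

record FlowGraph (n : ℕ) : Set where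
  field
    graph     : Digraph n
    s         : Fin n
    size>1    : 1 < n
    noArcIntoS : ∀ v → ¬ Arc graph v s
    reachable : ∀ w → Walk graph s w

  Dom : Fin n → Fin n → Set
  Dom v w = (p : Walk graph s w) → v ∈ verts graph p

open FlowGraph public

-- A rooted tree whose vertex set is a subset of Fin n:
-- membership predicate, root, and parent function t (meaningful on non-root members).
record RTree (n : ℕ) : Set where
  field
    mem  : Fin n → Bool
    root : Fin n
    t    : Fin n → Fin n

  In : Fin n → Set
  In v = mem v ≡ true

  data Anc : Fin n → Fin n → Set where
    here  : ∀ {v} → In v → Anc v v
    there : ∀ {v w} → In w → w ≢ root → Anc v (t w) → Anc v w

open RTree public

-- Tree axioms: the root is a member, parents of non-root members are members,
-- and the root is an ancestor of every member (so the parent structure is acyclic).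
record IsRootedTree {n : ℕ} (T : RTree n) : Set where
  field
    rootIn   : In T (root T)
    parentIn : ∀ w → In T w → w ≢ root T → In T (t T w)
    toRoot   : ∀ w → In T w → Anc T (root T) w

-- Parent property: for every arc (v,w), t(w) (defined, i.e. w is a non-root vertex of T)
-- is an ancestor of v in T.
ParentProperty : ∀ {n} → FlowGraph n → RTree n → Set
ParentProperty G T =
  ∀ v w → Arc (graph G) v w → In T w × w ≢ root T × Anc T (t T w) v

SiblingProperty : ∀ {n} → FlowGraph n → RTree n → Set
SiblingProperty G T =
  ∀ v w → In T v → In T w → v ≢ root T → w ≢ root T → v ≢ w →
  t T v ≡ t T w → ¬ Dom G v w

-- T = D, where D is the dominator tree: the tree rooted at s on all of V whose ancestor
-- relation is dominance.  Two rooted trees on the same vertex set with the same root and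
-- the same ancestor relation are equal, so T = D means exactly:
IsDominatorTree : ∀ {n} → FlowGraph n → RTree n → Set
IsDominatorTree G T =
  (∀ v → In T v) × root T ≡ s G ×
  (∀ v w → (Anc T v w → Dom G v w) × (Dom G v w → Anc T v w))

module Submission where

-- If T = D then ancestry is dominance.  For an arc (v,w),
-- w ≠ s, and the parent t(w) dominates w but is not w, so it dominates the
-- predecessor v (extend any walk to v by the arc): this is the parent property.
-- Siblings v,w with v dominating w would make v and t(v) = t(w) dominate each
-- other, contradicting antisymmetry of dominance.
--
-- The parent property alone gives: a walk ending in the
-- subtree of x either stays in it (and starts there) or has a suffix from x
-- inside it.  Hence the root is s, every vertex lies in T, and ancestors are
-- dominators.  For the converse we show that a proper dominator v of a
-- non-root w dominates t(w); otherwise v would be a descendant of t(w), and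
-- the child c of t(w) above v would be a sibling of w dominating w.  Climbing
-- from w to the root then shows that every dominator of w is an ancestor.

open import Defs
open import Data.Nat using (ℕ)
open import Data.Fin using (Fin; _≟_)
open import Data.Product using (Σ; _×_; _,_; proj₁; proj₂)
open import Data.Sum using (_⊎_; inj₁; inj₂; [_,_]; map₁)
open import Data.Empty using (⊥-elim)
open import Data.List using (List; []; _∷_)
open import Data.List.Membership.Propositional using (_∈_; _∉_)
import Data.List.Membership.DecPropositional as DecMembership
open import Data.List.Relation.Binary.Subset.Propositional using (_⊆_)
open import Data.List.Relation.Unary.Any using (here; there)
open import Data.List.Relation.Unary.All as All using (All; []; _∷_)
open import Relation.Binary.PropositionalEquality using (_≡_; _≢_; refl; sym; trans; subst)
open import Relation.Nullary using (yes; no)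
open import Function.Bundles using (_⇔_; mk⇔)

module Walks {n : ℕ} (Γ : Digraph n) where

  _++ʷ_ : ∀ {a b c} → Walk Γ a b → Walk Γ b c → Walk Γ a c
  [] ++ʷ r = r
  (e ∷ q) ++ʷ r = e ∷ (q ++ʷ r)

  start∈ : ∀ {a b} (p : Walk Γ a b) → a ∈ verts Γ p
  start∈ [] = here refl
  start∈ (_ ∷ _) = here refl

  end∈ : ∀ {a b} (p : Walk Γ a b) → b ∈ verts Γ p
  end∈ [] = here refl
  end∈ (_ ∷ p) = there (end∈ p)

  ∈-++ʷ : ∀ {a b c y} (q : Walk Γ a b) (r : Walk Γ b c) →
          y ∈ verts Γ (q ++ʷ r) → y ∈ verts Γ q ⊎ y ∈ verts Γ r
  ∈-++ʷ [] r m = inj₂ m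
  ∈-++ʷ (e ∷ q) r (here eq) = inj₁ (here eq)
  ∈-++ʷ (e ∷ q) r (there m) = map₁ there (∈-++ʷ q r m)

  earlier : ∀ {a b} → Walk Γ a b → List (Fin n)
  earlier [] = []
  earlier {a} (_ ∷ p) = a ∷ earlier p

  earlier-or-end : ∀ {a b y} (p : Walk Γ a b) → y ∈ verts Γ p → y ∈ earlier p ⊎ y ≡ b
  earlier-or-end [] (here eq) = inj₂ eq
  earlier-or-end (e ∷ p) (here eq) = inj₁ (here eq)
  earlier-or-end (e ∷ p) (there m) = map₁ there (earlier-or-end p m)

  prefix-earlier : ∀ {a b x} (p : Walk Γ a b) → x ∈ earlier p →
                   Σ (Walk Γ a x) λ p′ → verts Γ p′ ⊆ earlier p
  prefix-earlier (e ∷ p) (here refl) = [] , λ { (here eq) → here eq }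
  prefix-earlier (e ∷ p) (there m) with prefix-earlier p m
  ... | p′ , sub = (e ∷ p′) , λ { (here eq) → here eq ; (there k) → there (sub k) }

  first-visit : ∀ {a b x} (p : Walk Γ a b) → x ∈ verts Γ p →
                Σ (Walk Γ a x) λ p′ → x ∉ earlier p′ × verts Γ p′ ⊆ verts Γ p
  first-visit [] (here refl) = [] , (λ ()) , (λ m → m)
  first-visit (e ∷ p) (here refl) = [] , (λ ()) , λ { (here eq) → here eq }
  first-visit {a = a} {x = x} (e ∷ p) (there m) with x ≟ a
  ... | yes refl = [] , (λ ()) , λ { (here eq) → here eq }
  ... | no x≢a with first-visit p m
  ... | p′ , x∉ , sub = (e ∷ p′) , (λ { (here eq) → x≢a eq ; (there k) → x∉ k })
                        , λ { (here eq) → here eq ; (there k) → there (sub k) }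

  trivial-or-last-arc : ∀ {a b} → Walk Γ a b → a ≡ b ⊎ Σ (Fin n) λ v → Arc Γ v b
  trivial-or-last-arc [] = inj₁ refl
  trivial-or-last-arc (e ∷ p) with trivial-or-last-arc p
  ... | inj₁ refl = inj₂ (_ , e)
  ... | inj₂ arc = inj₂ arc

module Dominance {n : ℕ} (G : FlowGraph n) where
  open Walks (graph G)

  -- Dominance is transitive: cut a walk to w at v, which u must then dominate.
  dom-trans : ∀ {u v w} → Dom G u v → Dom G v w → Dom G u w
  dom-trans duv dvw p with first-visit p (dvw p)
  ... | p′ , _ , sub = sub (duv p′)

  -- Two vertices dominating each other are equal: on a walk to w cut at the first
  -- visit of v, w appears strictly before v, and cutting there avoids v.
  dom-antisym : ∀ {v w} → Dom G v w → Dom G w v → v ≡ w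
  dom-antisym {w = w} dvw dwv with first-visit (reachable G w) (dvw (reachable G w))
  ... | p₁ , v∉ , _ with earlier-or-end p₁ (dwv p₁)
  ... | inj₂ w≡v = sym w≡v
  ... | inj₁ w∈ with prefix-earlier p₁ w∈
  ... | p₂ , sub = ⊥-elim (v∉ (sub (dvw p₂)))

  -- The trivial walk shows that only s dominates s.
  dom-start : ∀ {v w} → w ≡ s G → Dom G v w → v ≡ w
  dom-start refl dvw with dvw []
  ... | here eq = eq

  dom-predecessor : ∀ {x v w} → Arc (graph G) v w → Dom G x w → x ≢ w → Dom G x v
  dom-predecessor e dxw x≢w p with ∈-++ʷ p (e ∷ []) (dxw (p ++ʷ (e ∷ [])))
  ... | inj₁ m = m
  ... | inj₂ (here refl) = end∈ p
  ... | inj₂ (there (here x≡w)) = ⊥-elim (x≢w x≡w)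

module Ancestry {n : ℕ} (T : RTree n) where

  anc-trans : ∀ {x y z} → Anc T x y → Anc T y z → Anc T x z
  anc-trans a (here _) = a
  anc-trans a (there iz nz b) = there iz nz (anc-trans a b)

  anc-root : ∀ {x} → Anc T x (root T) → x ≡ root T
  anc-root (here _) = refl
  anc-root (there _ nr _) = ⊥-elim (nr refl)

  parent-anc : ∀ {w} → In T w → w ≢ root T → In T (t T w) → Anc T (t T w) w
  parent-anc iw nw itw = there iw nw (here itw)

  child-towards : ∀ {x y} → Anc T x y → x ≢ y →
                  Σ (Fin n) λ c → In T c × c ≢ root T × t T c ≡ x × Anc T c y
  child-towards (here _) x≢y = ⊥-elim (x≢y refl)
  child-towards {x} (there {w = y} iy ny a) x≢y with x ≟ t T y
  ... | yes eq = y , iy , ny , sym eq , here iy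
  ... | no x≢ty with child-towards a x≢ty
  ... | c , ic , nc , tc , acy = c , ic , nc , tc , there iy ny acy

  anc-fixed-point : ∀ {x y z} → t T z ≡ z → Anc T x y → y ≡ z → x ≡ z
  anc-fixed-point _ (here _) y≡z = y≡z
  anc-fixed-point tz (there _ _ a) refl = anc-fixed-point tz a tz

  parent≢self : IsRootedTree T → ∀ {w} → In T w → w ≢ root T → t T w ≢ w
  parent≢self isT iw nw tw≡w =
    nw (sym (anc-fixed-point tw≡w (IsRootedTree.toRoot isT _ iw) refl))

module FromDominatorTree {n : ℕ} (G : FlowGraph n) (T : RTree n)
                         (isT : IsRootedTree T) (D : IsDominatorTree G T) where
  open Dominance G
  open Ancestry T

  allIn : ∀ v → In T v
  allIn = proj₁ D

  anc⇒dom : ∀ {v w} → Anc T v w → Dom G v w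
  anc⇒dom = proj₁ (proj₂ (proj₂ D) _ _)

  dom⇒anc : ∀ {v w} → Dom G v w → Anc T v w
  dom⇒anc = proj₂ (proj₂ (proj₂ D) _ _)

  parent-dom : ∀ {w} → w ≢ root T → Dom G (t T w) w
  parent-dom nw = anc⇒dom (parent-anc (allIn _) nw (allIn _))

  -- The target w of an arc is not s = root, and t(w) ≠ w dominates w, hence its
  -- predecessor v: so t(w) is an ancestor of v.
  parentProperty : ParentProperty G T
  parentProperty v w e = allIn w , w≢root , dom⇒anc (dom-predecessor e (parent-dom w≢root) tw≢w)
    where
    w≢root : w ≢ root T
    w≢root w≡root = noArcIntoS G v (subst (Arc (graph G) v) (trans w≡root (proj₁ (proj₂ D))) e)
    tw≢w : t T w ≢ w
    tw≢w = parent≢self isT (allIn w) w≢root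

  -- A sibling v dominating w would be a proper ancestor of w, hence of t(w) = t(v).
  siblingProperty : SiblingProperty G T
  siblingProperty v w iv iw nv nw v≢w tv≡tw dvw with dom⇒anc dvw
  ... | here _ = v≢w refl
  ... | there _ _ a = parent≢self isT iv nv
                        (sym (dom-antisym (anc⇒dom (subst (Anc T v) (sym tv≡tw) a)) (parent-dom nv)))

module ToDominatorTree {n : ℕ} (G : FlowGraph n) (T : RTree n) (isT : IsRootedTree T)
                       (PP : ParentProperty G T) (SP : SiblingProperty G T) where
  open IsRootedTree isT
  open Walks (graph G)
  open Dominance G
  open Ancestry T
  open DecMembership (_≟_ {n}) using (_∈?_)

  parent-anc-tail : ∀ {v w} → Arc (graph G) v w → Anc T (t T w) v
  parent-anc-tail {v} {w} e = proj₂ (proj₂ (PP v w e))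

  -- By the parent property a walk can only enter the subtree of x through x.
  subtree-suffix : ∀ {u w x} (p : Walk (graph G) u w) → Anc T x w →
    (Anc T x u × All (Anc T x) (verts (graph G) p))
    ⊎ Σ (Walk (graph G) x w) λ r → All (Anc T x) (verts (graph G) r) × verts (graph G) r ⊆ verts (graph G) p
  subtree-suffix [] a = inj₁ (a , a ∷ [])
  subtree-suffix (e ∷ p) a with subtree-suffix p a
  ... | inj₂ (r , inside , sub) = inj₂ (r , inside , λ m → there (sub m))
  ... | inj₁ (here _ , inside) = inj₂ (p , inside , there)
  ... | inj₁ (there _ _ b , inside) =
    let au = anc-trans b (parent-anc-tail e) in inj₁ (au , au ∷ inside)

  walk-meets-ancestor : ∀ {u w x} (p : Walk (graph G) u w) → Anc T x w →
                        x ∈ verts (graph G) p ⊎ Anc T x u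
  walk-meets-ancestor p a with subtree-suffix p a
  ... | inj₁ (au , _) = inj₂ au
  ... | inj₂ (r , _ , sub) = inj₁ (sub (start∈ r))

  -- The root has no entering arc, so it is the start vertex.
  root≡s : root T ≡ s G
  root≡s with trivial-or-last-arc (reachable G (root T))
  ... | inj₁ s≡root = sym s≡root
  ... | inj₂ (v , e) = ⊥-elim (proj₁ (proj₂ (PP v (root T) e)) refl)

  -- Every vertex is s = root or has an entering arc, so it belongs to T.
  allIn : ∀ w → In T w
  allIn w with trivial-or-last-arc (reachable G w)
  ... | inj₁ s≡w = subst (In T) (trans root≡s s≡w) rootIn
  ... | inj₂ (v , e) = proj₁ (PP v w e)

  anc-start : ∀ {x} → Anc T x (s G) → x ≡ s G
  anc-start a = trans (anc-root (subst (Anc T _) (sym root≡s) a)) root≡s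

  anc⇒dom : ∀ {x w} → Anc T x w → Dom G x w
  anc⇒dom a p with walk-meets-ancestor p a
  ... | inj₁ x∈p = x∈p
  ... | inj₂ a-start = subst (_∈ verts (graph G) p) (sym (anc-start a-start)) (start∈ p)

  -- A dominator v of w missed by some walk to an ancestor x of w lies below x:
  -- v must lie on the part of a walk to w that stays in the subtree of x.
  dominator-below : ∀ {v w x} → Dom G v w → Anc T x w → (q : Walk (graph G) (s G) x) →
                    v ∉ verts (graph G) q → Anc T x v
  dominator-below {w = w} dvw axw q v∉q with subtree-suffix (reachable G w) axw
  ... | inj₁ (_ , inside) = All.lookup inside (dvw (reachable G w))
  ... | inj₂ (r , inside , _) =
    [ (λ v∈q → ⊥-elim (v∉q v∈q)) , All.lookup inside ] (∈-++ʷ q r (dvw (q ++ʷ r)))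

  -- A proper dominator v of a non-root w dominates t(w).  Otherwise v lies below
  -- t(w), and the child c of t(w) above v is a sibling of w dominating w.
  dom-parent : ∀ {v w} → In T w → w ≢ root T → v ≢ w → Dom G v w → Dom G v (t T w)
  dom-parent {v} {w} iw nw v≢w dvw q with v ∈? verts (graph G) q
  ... | yes v∈q = v∈q
  ... | no v∉q with child-towards (dominator-below dvw (parent-anc iw nw (parentIn w iw nw)) q v∉q)
                                  (λ tw≡v → v∉q (subst (_∈ verts (graph G) q) tw≡v (end∈ q)))
  ... | c , ic , nc , tc≡tw , acv = ⊥-elim (SP c w ic iw nc nw c≢w tc≡tw dcw)
    where
    dcw : Dom G c w
    dcw = dom-trans (anc⇒dom acv) dvw
    c≢w : c ≢ w
    c≢w refl = v≢w (dom-antisym dvw (anc⇒dom acv))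

  -- Climbing from w to the root: every dominator of w is an ancestor of w.
  dom⇒anc : ∀ {w} → Anc T (root T) w → ∀ {v} → Dom G v w → Anc T v w
  dom⇒anc (here i) dvw = subst (λ z → Anc T z (root T)) (sym (dom-start root≡s dvw)) (here i)
  dom⇒anc (there {w = w} iw nw a) {v} dvw with v ≟ w
  ... | yes refl = here iw
  ... | no v≢w = there iw nw (dom⇒anc a (dom-parent iw nw v≢w dvw))

  isDominatorTree : IsDominatorTree G T
  isDominatorTree = allIn , root≡s , λ v w → anc⇒dom , dom⇒anc (toRoot w (allIn w))

theorem5 : ∀ {n} (G : FlowGraph n) (T : RTree n) → IsRootedTree T →
    (ParentProperty G T × SiblingProperty G T) ⇔ IsDominatorTree G T
theorem5 G T isT = mk⇔
  (λ (pp , sp) → ToDominatorTree.isDominatorTree G T isT pp sp)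
  (λ D → FromDominatorTree.parentProperty G T isT D , FromDominatorTree.siblingProperty G T isT D)
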